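{- For all $\alpha\in E$, $d\in\mathbb N$ and sequents $\Gamma$: if $\vdash^\alpha_{d+1}\Gamma$ then $\vdash^{\omega(\alpha)}_d\Gamma$; and if $\vdash^\alpha_d\Gamma$ then $\vdash^{\omega(\alpha,d)}_0\Gamma$, where $\omega(\alpha,0)=\alpha$ and $\omega(\alpha,n+1)=\omega(\omega(\alpha,n))$.
   Context: $\mathcal L_{\mathsf{PA}}$ is the first-order language with constant $0$, unary function $S$, binary functions $+,\times$ and binary relations $\leq,=$; $\mathcal L^X_{\mathsf{PA}}$ adds a unary relation symbol $X$. Formulas are in negation normal form: built from literals by $\land,\lor,\forall,\exists$; $\neg\varphi$ is defined via de Morgan's laws (so $\neg\neg\varphi$ is $\varphi$). "True" refers to the standard model $\mathbb N$. Rank: literals have rank $0$, $\mathrm{rk}(\varphi_0\land\varphi_1)=\mathrm{rk}(\varphi_0\lor\varphi_1)=\max+1$, $\mathrm{rk}(\forall x\varphi)=\mathrm{rk}(\exists x\varphi)=\mathrm{rk}(\varphi)+1$. $(E,\prec)$ is a well order with: a unary map $\alpha\mapsto\alpha+1$ with $\alpha\prec\alpha+1$; elements $0,\omega\in E$ with $0\prec\omega$ such that $\alpha\prec\omega$ implies $\alpha+1\prec\omega$; a binary operation $+:E^2\to E$ (distinct from the unary map, which is always meant by "$\alpha+1$") with $\alpha+0=\alpha$ and $\beta\prec\gamma\Rightarrow\alpha+\beta\prec\alpha+\gamma$; a map $\omega:E\to E$ with $\alpha\prec\beta\Rightarrow\omega(\alpha)\prec\omega(\beta)$ and $\alpha,\beta\prec\omega(\gamma)\Rightarrow\alpha+\beta\prec\omega(\gamma)$;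 moreover $\alpha\prec\beta$ implies $\alpha+1\preceq\beta$, and $0\preceq\alpha$ for all $\alpha$. $x\lhd y$ is a fixed $\mathcal L_{\mathsf{PA}}$-formula with free variables $x,y$ only, defining a well order on $\mathbb N$. A sequent is a finite set of $\mathcal L^X_{\mathsf{PA}}$-sentences; $\Gamma,\varphi$ denotes $\Gamma\cup\{\varphi\}$. By recursion on $\alpha\in E$, $\vdash^\alpha_d\Gamma$ holds exactly if one of: (i) $\Gamma$ contains a true $\mathcal L_{\mathsf{PA}}$-literal, or $Xs$ and $\neg Xt$ with closed terms $s,t$ of equal value; (ii) $\Gamma$ contains $\varphi_0\land\varphi_1$ (resp. $\varphi_0\lor\varphi_1$) and for every (resp. some) $i\in\{0,1\}$: $\vdash^{\alpha(i)}_{d(i)}\Delta_i$ with $\alpha(i)\prec\alpha$, $d(i)\leq d$, $\Delta_i\subseteq\Gamma,\varphi_i$; (iii) $\Gamma$ contains $\forall x\varphi$ (resp. $\exists x\varphi$) and for every (resp. some) closed term $t$: $\vdash^{\alpha(t)}_{d(t)}\Delta_t$ with $\alpha(t)\prec\alpha$, $d(t)\leq d$, $\Delta_t\subseteq\Gamma,\varphi[x/t]$; (iv) $\Gamma$ contains $Xt$ and for every closed term $s$ with $s\lhd t$ (by value): $\vdash^{\alpha(s)}_{d(s)}\Delta_s$ with $\alpha(s)\prec\alpha$, $d(s)\leq d$, $\Delta_s\subseteq\Gamma,Xs$; (v) for some sentence $\varphi$ with $\mathrm{rk}(\varphi)<d$: $\vdash^{\alpha(0)}_{d(0)}\Delta_0$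 and $\vdash^{\alpha(1)}_{d(1)}\Delta_1$ with $\alpha(i)\prec\alpha$, $d(i)\leq d$, $\Delta_0\subseteq\Gamma,\varphi$, $\Delta_1\subseteq\Gamma,\neg\varphi$. -}

module Defs where

open import Data.Nat using (ℕ; zero; suc; _≤_; _<_) renaming (_+_ to _+ℕ_; _*_ to _*ℕ_)
open import Data.Fin using (Fin; zero; suc)
open import Data.List using (List; _∷_)
open import Data.List.Membership.Propositional using (_∈_)
open import Data.Product using (Σ; _×_; _,_; ∃)
open import Data.Sum using (_⊎_)
open import Data.Empty using (⊥)
open import Data.Unit using (⊤)
open import Relation.Nullary using (¬_)
open import Relation.Binary.PropositionalEquality using (_≡_; _≢_)
open import Induction.WellFounded using (WellFounded)

-- Syntax of L^X_PA (de Bruijn scoped: Term n / Formula n have n free vars)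

data Term (n : ℕ) : Set where
  var  : Fin n → Term n
  `0   : Term n
  `S   : Term n → Term n
  _`+_ : Term n → Term n → Term n
  _`×_ : Term n → Term n → Term n

-- Formulas in negation normal form
data Formula (n : ℕ) : Set where
  _`=_  : Term n → Term n → Formula n
  _`≠_  : Term n → Term n → Formula n
  _`≤_  : Term n → Term n → Formula n
  _`≰_  : Term n → Term n → Formula n
  `X    : Term n → Formula n
  `¬X   : Term n → Formula n
  _`∧_  : Formula n → Formula n → Formula n
  _`∨_  : Formula n → Formula n → Formula n
  `∀    : Formula (suc n) → Formula n
  `∃    : Formula (suc n) → Formula n

ClosedTerm : Set
ClosedTerm = Term 0

Sentence : Set
Sentence = Formula 0

neg : ∀ {n} → Formula n → Formula n
neg (s `= t) = s `≠ t
neg (s `≠ t) = s `= t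
neg (s `≤ t) = s `≰ t
neg (s `≰ t) = s `≤ t
neg (`X t)   = `¬X t
neg (`¬X t)  = `X t
neg (φ `∧ ψ) = neg φ `∨ neg ψ
neg (φ `∨ ψ) = neg φ `∧ neg ψ
neg (`∀ φ)   = `∃ (neg φ)
neg (`∃ φ)   = `∀ (neg φ)

rk : ∀ {n} → Formula n → ℕ
rk (φ `∧ ψ) = suc (Data.Nat._⊔_ (rk φ) (rk ψ))
rk (φ `∨ ψ) = suc (Data.Nat._⊔_ (rk φ) (rk ψ))
rk (`∀ φ)   = suc (rk φ)
rk (`∃ φ)   = suc (rk φ)
rk _        = 0

IsPA : ∀ {n} → Formula n → Set
IsPA (`X t)   = ⊥
IsPA (`¬X t)  = ⊥
IsPA (φ `∧ ψ) = IsPA φ × IsPA ψ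
IsPA (φ `∨ ψ) = IsPA φ × IsPA ψ
IsPA (`∀ φ)   = IsPA φ
IsPA (`∃ φ)   = IsPA φ
IsPA _        = ⊤

renT : ∀ {n m} → (Fin n → Fin m) → Term n → Term m
renT r (var i)  = var (r i)
renT r `0       = `0
renT r (`S t)   = `S (renT r t)
renT r (s `+ t) = renT r s `+ renT r t
renT r (s `× t) = renT r s `× renT r t

substT : ∀ {n m} → (Fin n → Term m) → Term n → Term m
substT σ (var i)  = σ i
substT σ `0       = `0
substT σ (`S t)   = `S (substT σ t)
substT σ (s `+ t) = substT σ s `+ substT σ t
substT σ (s `× t) = substT σ s `× substT σ t

lift : ∀ {n m} → (Fin n → Term m) → Fin (suc n) → Term (suc m)
lift σ zero    = var zero
lift σ (suc i) = renT suc (σ i)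

substF : ∀ {n m} → (Fin n → Term m) → Formula n → Formula m
substF σ (s `= t) = substT σ s `= substT σ t
substF σ (s `≠ t) = substT σ s `≠ substT σ t
substF σ (s `≤ t) = substT σ s `≤ substT σ t
substF σ (s `≰ t) = substT σ s `≰ substT σ t
substF σ (`X t)   = `X (substT σ t)
substF σ (`¬X t)  = `¬X (substT σ t)
substF σ (φ `∧ ψ) = substF σ φ `∧ substF σ ψ
substF σ (φ `∨ ψ) = substF σ φ `∨ substF σ ψ
substF σ (`∀ φ)   = `∀ (substF (lift σ) φ)
substF σ (`∃ φ)   = `∃ (substF (lift σ) φ)

-- φ[x/t] for the bound variable x of ∀x φ / ∃x φ (de Bruijn index 0)
inst : Formula 1 → ClosedTerm → Sentence
inst φ t = substF (λ { zero → t }) φ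

⟦_⟧ : ∀ {n} → Term n → (Fin n → ℕ) → ℕ
⟦ var i ⟧  ρ = ρ i
⟦ `0 ⟧     ρ = 0
⟦ `S t ⟧   ρ = suc (⟦ t ⟧ ρ)
⟦ s `+ t ⟧ ρ = ⟦ s ⟧ ρ +ℕ ⟦ t ⟧ ρ
⟦ s `× t ⟧ ρ = ⟦ s ⟧ ρ *ℕ ⟦ t ⟧ ρ

val : ClosedTerm → ℕ
val t = ⟦ t ⟧ (λ ())

_∷ρ_ : ∀ {n} → ℕ → (Fin n → ℕ) → Fin (suc n) → ℕ
(a ∷ρ ρ) zero    = a
(a ∷ρ ρ) (suc i) = ρ i

-- Tarski truth in ℕ, with X interpreted by a given predicate
-- (only used for L_PA formulas, where the interpretation of X is irrelevant)
Sat : ∀ {n} → (ℕ → Set) → Formula n → (Fin n → ℕ) → Set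
Sat P (s `= t) ρ = ⟦ s ⟧ ρ ≡ ⟦ t ⟧ ρ
Sat P (s `≠ t) ρ = ⟦ s ⟧ ρ ≢ ⟦ t ⟧ ρ
Sat P (s `≤ t) ρ = ⟦ s ⟧ ρ ≤ ⟦ t ⟧ ρ
Sat P (s `≰ t) ρ = ¬ (⟦ s ⟧ ρ ≤ ⟦ t ⟧ ρ)
Sat P (`X t)   ρ = P (⟦ t ⟧ ρ)
Sat P (`¬X t)  ρ = ¬ P (⟦ t ⟧ ρ)
Sat P (φ `∧ ψ) ρ = Sat P φ ρ × Sat P ψ ρ
Sat P (φ `∨ ψ) ρ = Sat P φ ρ ⊎ Sat P ψ ρ
Sat P (`∀ φ)   ρ = ∀ (a : ℕ) → Sat P φ (a ∷ρ ρ)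
Sat P (`∃ φ)   ρ = Σ ℕ (λ a → Sat P φ (a ∷ρ ρ))

TrueLit : Sentence → Set
TrueLit (s `= t) = val s ≡ val t
TrueLit (s `≠ t) = val s ≢ val t
TrueLit (s `≤ t) = val s ≤ val t
TrueLit (s `≰ t) = ¬ (val s ≤ val t)
TrueLit _        = ⊥

-- the relation defined by a formula with free variables x (index 0), y (index 1)
Rel⟨_⟩ : Formula 2 → ℕ → ℕ → Set
Rel⟨ θ ⟩ x y = Sat (λ _ → ⊥) θ (x ∷ρ (y ∷ρ (λ ())))

record DefinesWellOrder (θ : Formula 2) : Set where
  field
    isPA   : IsPA θ
    irrefl : ∀ x → ¬ Rel⟨ θ ⟩ x x
    trans  : ∀ x y z → Rel⟨ θ ⟩ x y → Rel⟨ θ ⟩ y z → Rel⟨ θ ⟩ x z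
    total  : ∀ x y → ¬ ¬ (Rel⟨ θ ⟩ x y ⊎ x ≡ y ⊎ Rel⟨ θ ⟩ y x)
    wf     : WellFounded (Rel⟨ θ ⟩)

record OrdStructure : Set₁ where
  field
    E      : Set
    _≺_    : E → E → Set
    ≺-irrefl : ∀ α → ¬ (α ≺ α)
    ≺-trans  : ∀ {α β γ} → α ≺ β → β ≺ γ → α ≺ γ
    ≺-total  : ∀ α β → ¬ ¬ (α ≺ β ⊎ α ≡ β ⊎ β ≺ α)
    ≺-wf     : WellFounded _≺_
    succ   : E → E
    zeroE  : E
    omega  : E
    _⊕_    : E → E → E
    ωf     : E → E
    succ-≻      : ∀ α → α ≺ succ α
    zero≺omega  : zeroE ≺ omega
    succ-omega  : ∀ {α} → α ≺ omega → succ α ≺ omega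
    ⊕-zero      : ∀ α → (α ⊕ zeroE) ≡ α
    ⊕-monoʳ     : ∀ α {β γ} → β ≺ γ → (α ⊕ β) ≺ (α ⊕ γ)
    ωf-mono     : ∀ {α β} → α ≺ β → ωf α ≺ ωf β
    ωf-closed   : ∀ {α β γ} → α ≺ ωf γ → β ≺ ωf γ → (α ⊕ β) ≺ ωf γ
    ≺⇒succ⪯     : ∀ {α β} → α ≺ β → (succ α ≺ β ⊎ succ α ≡ β)
    zero⪯       : ∀ α → (zeroE ≺ α ⊎ zeroE ≡ α)

Sequent : Set
Sequent = List Sentence

_⊆_,_ : Sequent → Sequent → Sentence → Set
Δ ⊆ Γ , φ = ∀ {ψ} → ψ ∈ Δ → ψ ∈ Γ ⊎ ψ ≡ φ

pick : Sentence → Sentence → Fin 2 → Sentence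
pick φ₀ φ₁ zero       = φ₀
pick φ₀ φ₁ (suc zero) = φ₁

module Derivability (O : OrdStructure) (θ : Formula 2) where
  open OrdStructure O

  _⊲_ : ClosedTerm → ClosedTerm → Set
  s ⊲ t = Rel⟨ θ ⟩ (val s) (val t)

  data ⊢ (α : E) (d : ℕ) (Γ : Sequent) : Set where
    ax-lit : ∀ {l} → l ∈ Γ → TrueLit l → ⊢ α d Γ
    ax-X   : ∀ {s t} → `X s ∈ Γ → `¬X t ∈ Γ → val s ≡ val t → ⊢ α d Γ
    r-∧    : ∀ {φ₀ φ₁} → (φ₀ `∧ φ₁) ∈ Γ →
             ((i : Fin 2) → let φ = pick φ₀ φ₁ i in
               Σ E λ β → Σ ℕ λ e → Σ Sequent λ Δ →
                 β ≺ α × e ≤ d × (Δ ⊆ Γ , φ) × ⊢ β e Δ) →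
             ⊢ α d Γ
    r-∨    : ∀ {φ₀ φ₁} → (φ₀ `∨ φ₁) ∈ Γ →
             (Σ (Fin 2) λ i → let φ = pick φ₀ φ₁ i in
               Σ E λ β → Σ ℕ λ e → Σ Sequent λ Δ →
                 β ≺ α × e ≤ d × (Δ ⊆ Γ , φ) × ⊢ β e Δ) →
             ⊢ α d Γ
    r-∀    : ∀ {φ} → `∀ φ ∈ Γ →
             ((t : ClosedTerm) →
               Σ E λ β → Σ ℕ λ e → Σ Sequent λ Δ →
                 β ≺ α × e ≤ d × (Δ ⊆ Γ , inst φ t) × ⊢ β e Δ) →
             ⊢ α d Γ
    r-∃    : ∀ {φ} → `∃ φ ∈ Γ →
             (Σ ClosedTerm λ t →
               Σ E λ β → Σ ℕ λ e → Σ Sequent λ Δ →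
                 β ≺ α × e ≤ d × (Δ ⊆ Γ , inst φ t) × ⊢ β e Δ) →
             ⊢ α d Γ
    r-X    : ∀ {t} → `X t ∈ Γ →
             ((s : ClosedTerm) → s ⊲ t →
               Σ E λ β → Σ ℕ λ e → Σ Sequent λ Δ →
                 β ≺ α × e ≤ d × (Δ ⊆ Γ , `X s) × ⊢ β e Δ) →
             ⊢ α d Γ
    r-cut  : (φ : Sentence) → rk φ < d →
             (Σ E λ β → Σ ℕ λ e → Σ Sequent λ Δ →
                 β ≺ α × e ≤ d × (Δ ⊆ Γ , φ) × ⊢ β e Δ) →
             (Σ E λ β → Σ ℕ λ e → Σ Sequent λ Δ →
                 β ≺ α × e ≤ d × (Δ ⊆ Γ , neg φ) × ⊢ β e Δ) →
             ⊢ α d Γ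

  ωn : E → ℕ → E
  ωn α zero    = α
  ωn α (suc n) = ωf (ωn α n)

-- Of a cut formula φ and its negation one is Positive (a disjunction, an
-- existential, a negated X-atom or a false literal): it can only be introduced
-- by ∨/∃ or as the ¬X side of an X-axiom, while its negation can be inverted at
-- no cost. Replacing each introduction of ψ in a derivation of Γ,ψ by a cut on
-- its lower-rank component against the inverted derivation of Γ,¬ψ removes the
-- cut on ψ at ordinal α ⊕ β. Applied bottom-up to all cuts of maximal rank,
-- premise ordinals β ≺ α become ωf β ≺ ωf α, and ωf α is closed under ⊕.
module Submission where

open import Defs
open import Data.Nat using (ℕ; zero; suc; _≤_; _<_; _⊔_; s≤s; s≤s⁻¹)
open import Data.Nat.Properties using (≤-refl; ≤-trans; <-≤-trans; m≤m⊔n; m≤n⊔m; _≟_; _≤?_)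
open import Data.Fin using (Fin; zero; suc)
open import Data.List using (_∷_)
open import Data.List.Relation.Unary.Any using (here; there)
open import Data.List.Membership.Propositional using (_∈_)
open import Data.Product using (Σ; _×_; _,_)
open import Data.Sum using (_⊎_; inj₁; inj₂)
open import Data.Empty using (⊥-elim)
open import Relation.Nullary using (¬_; yes; no)
open import Relation.Binary.PropositionalEquality using (_≡_; refl; sym; trans; cong; cong₂; subst)

neg-involutive : ∀ {n} (φ : Formula n) → neg (neg φ) ≡ φ
neg-involutive (s `= t) = refl
neg-involutive (s `≠ t) = refl
neg-involutive (s `≤ t) = refl
neg-involutive (s `≰ t) = refl
neg-involutive (`X t)   = refl
neg-involutive (`¬X t)  = refl
neg-involutive (φ `∧ ψ) = cong₂ _`∧_ (neg-involutive φ) (neg-involutive ψ)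
neg-involutive (φ `∨ ψ) = cong₂ _`∨_ (neg-involutive φ) (neg-involutive ψ)
neg-involutive (`∀ φ)   = cong `∀ (neg-involutive φ)
neg-involutive (`∃ φ)   = cong `∃ (neg-involutive φ)

rk-neg : ∀ {n} (φ : Formula n) → rk (neg φ) ≡ rk φ
rk-neg (s `= t) = refl
rk-neg (s `≠ t) = refl
rk-neg (s `≤ t) = refl
rk-neg (s `≰ t) = refl
rk-neg (`X t)   = refl
rk-neg (`¬X t)  = refl
rk-neg (φ `∧ ψ) = cong₂ (λ a b → suc (a ⊔ b)) (rk-neg φ) (rk-neg ψ)
rk-neg (φ `∨ ψ) = cong₂ (λ a b → suc (a ⊔ b)) (rk-neg φ) (rk-neg ψ)
rk-neg (`∀ φ)   = cong suc (rk-neg φ)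
rk-neg (`∃ φ)   = cong suc (rk-neg φ)

rk-substF : ∀ {n m} (σ : Fin n → Term m) (φ : Formula n) → rk (substF σ φ) ≡ rk φ
rk-substF σ (s `= t) = refl
rk-substF σ (s `≠ t) = refl
rk-substF σ (s `≤ t) = refl
rk-substF σ (s `≰ t) = refl
rk-substF σ (`X t)   = refl
rk-substF σ (`¬X t)  = refl
rk-substF σ (φ `∧ ψ) = cong₂ (λ a b → suc (a ⊔ b)) (rk-substF σ φ) (rk-substF σ ψ)
rk-substF σ (φ `∨ ψ) = cong₂ (λ a b → suc (a ⊔ b)) (rk-substF σ φ) (rk-substF σ ψ)
rk-substF σ (`∀ φ)   = cong suc (rk-substF (lift σ) φ)
rk-substF σ (`∃ φ)   = cong suc (rk-substF (lift σ) φ)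

substF-neg : ∀ {n m} (σ : Fin n → Term m) (φ : Formula n) → substF σ (neg φ) ≡ neg (substF σ φ)
substF-neg σ (s `= t) = refl
substF-neg σ (s `≠ t) = refl
substF-neg σ (s `≤ t) = refl
substF-neg σ (s `≰ t) = refl
substF-neg σ (`X t)   = refl
substF-neg σ (`¬X t)  = refl
substF-neg σ (φ `∧ ψ) = cong₂ _`∨_ (substF-neg σ φ) (substF-neg σ ψ)
substF-neg σ (φ `∨ ψ) = cong₂ _`∧_ (substF-neg σ φ) (substF-neg σ ψ)
substF-neg σ (`∀ φ)   = cong `∃ (substF-neg (lift σ) φ)
substF-neg σ (`∃ φ)   = cong `∀ (substF-neg (lift σ) φ)

rk-pick< : ∀ φ₀ φ₁ (i : Fin 2) → rk (pick φ₀ φ₁ i) < rk (φ₀ `∨ φ₁)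
rk-pick< φ₀ φ₁ zero       = s≤s (m≤m⊔n (rk φ₀) (rk φ₁))
rk-pick< φ₀ φ₁ (suc zero) = s≤s (m≤n⊔m (rk φ₀) (rk φ₁))

rk-inst< : ∀ φ t → rk (inst φ t) < rk (`∃ φ)
rk-inst< φ t = s≤s (subst (_≤ rk φ) (sym (rk-substF _ φ)) ≤-refl)

data Positive : Sentence → Set where
  ∨-pos  : ∀ {φ₀ φ₁} → Positive (φ₀ `∨ φ₁)
  ∃-pos  : ∀ {φ} → Positive (`∃ φ)
  ¬X-pos : ∀ {t} → Positive (`¬X t)
  =-pos  : ∀ {s t} → ¬ val s ≡ val t → Positive (s `= t)
  ≠-pos  : ∀ {s t} → val s ≡ val t → Positive (s `≠ t)
  ≤-pos  : ∀ {s t} → ¬ val s ≤ val t → Positive (s `≤ t)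
  ≰-pos  : ∀ {s t} → val s ≤ val t → Positive (s `≰ t)

Positive⇒¬TrueLit : ∀ {ψ} → Positive ψ → ¬ TrueLit ψ
Positive⇒¬TrueLit (=-pos s≢t) s≡t = s≢t s≡t
Positive⇒¬TrueLit (≠-pos s≡t) s≢t = s≢t s≡t
Positive⇒¬TrueLit (≤-pos s≰t) s≤t = s≰t s≤t
Positive⇒¬TrueLit (≰-pos s≤t) s≰t = s≰t s≤t

Positive-or-neg : (φ : Sentence) → Positive φ ⊎ Positive (neg φ)
Positive-or-neg (s `= t) with val s ≟ val t
... | yes s≡t = inj₂ (≠-pos s≡t)
... | no  s≢t = inj₁ (=-pos s≢t)
Positive-or-neg (s `≠ t) with val s ≟ val t
... | yes s≡t = inj₁ (≠-pos s≡t)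
... | no  s≢t = inj₂ (=-pos s≢t)
Positive-or-neg (s `≤ t) with val s ≤? val t
... | yes s≤t = inj₂ (≰-pos s≤t)
... | no  s≰t = inj₁ (≤-pos s≰t)
Positive-or-neg (s `≰ t) with val s ≤? val t
... | yes s≤t = inj₁ (≰-pos s≤t)
... | no  s≰t = inj₂ (≤-pos s≰t)
Positive-or-neg (`X t)   = inj₂ ¬X-pos
Positive-or-neg (`¬X t)  = inj₁ ¬X-pos
Positive-or-neg (φ `∧ ψ) = inj₂ ∨-pos
Positive-or-neg (φ `∨ ψ) = inj₁ ∨-pos
Positive-or-neg (`∀ φ)   = inj₂ ∃-pos
Positive-or-neg (`∃ φ)   = inj₁ ∃-pos

-- χ ⇝ ψ: in a derivation of Γ,χ the formula χ may be replaced by ψ without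
-- increasing ordinal or cut rank (inversion of ∧ and ∀, extensionality of X).
data _⇝_ : Sentence → Sentence → Set where
  ∧⇝ : ∀ {φ₀ φ₁} (i : Fin 2) → (φ₀ `∧ φ₁) ⇝ pick φ₀ φ₁ i
  ∀⇝ : ∀ {φ} (t : ClosedTerm) → `∀ φ ⇝ inst φ t
  X⇝ : ∀ {s t} → val s ≡ val t → `X t ⇝ `X s

⇝⇒¬TrueLit : ∀ {χ ψ} → χ ⇝ ψ → ¬ TrueLit χ
⇝⇒¬TrueLit (∧⇝ i) ()
⇝⇒¬TrueLit (∀⇝ t) ()
⇝⇒¬TrueLit (X⇝ _) ()

neg-∨⇝ : ∀ {φ₀ φ₁} (i : Fin 2) → neg (φ₀ `∨ φ₁) ⇝ neg (pick φ₀ φ₁ i)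
neg-∨⇝ zero       = ∧⇝ zero
neg-∨⇝ (suc zero) = ∧⇝ (suc zero)

neg-∃⇝ : ∀ {φ} (t : ClosedTerm) → neg (`∃ φ) ⇝ neg (inst φ t)
neg-∃⇝ {φ} t = subst (neg (`∃ φ) ⇝_) (substF-neg _ φ) (∀⇝ t)

∷-⊆ : ∀ {φ Γ} → (φ ∷ Γ) ⊆ Γ , φ
∷-⊆ (here refl) = inj₂ refl
∷-⊆ (there φ∈Γ) = inj₁ φ∈Γ

⊆-weaken : ∀ {Γ₁ Γ χ φ} → Γ₁ ⊆ Γ , χ → Γ₁ ⊆ (φ ∷ Γ) , χ
⊆-weaken Γ₁⊆ ψ∈ with Γ₁⊆ ψ∈
... | inj₁ ψ∈Γ = inj₁ (there ψ∈Γ)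
... | inj₂ ψ≡χ = inj₂ ψ≡χ

⊆-trans : ∀ {Δ Γ₁ Γ φ χ} → Δ ⊆ Γ₁ , φ → Γ₁ ⊆ Γ , χ → Δ ⊆ (φ ∷ Γ) , χ
⊆-trans Δ⊆ Γ₁⊆ ψ∈ with Δ⊆ ψ∈
... | inj₂ refl = inj₁ (here refl)
... | inj₁ ψ∈Γ₁ = ⊆-weaken Γ₁⊆ ψ∈Γ₁

⊆-trans-∈ : ∀ {Δ Γ₁ Γ φ χ} → Δ ⊆ Γ₁ , φ → Γ₁ ⊆ Γ , χ → φ ∈ Γ → Δ ⊆ Γ , χ
⊆-trans-∈ Δ⊆ Γ₁⊆ φ∈Γ ψ∈ with Δ⊆ ψ∈
... | inj₂ refl = inj₁ φ∈Γ
... | inj₁ ψ∈Γ₁ = Γ₁⊆ ψ∈Γ₁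

module CutElimination (O : OrdStructure) (θ : Formula 2) where
  open OrdStructure O
  open Derivability O θ

  Premise : E → ℕ → Sequent → Sentence → Set
  Premise α d Γ φ = Σ E λ β → Σ ℕ λ e → Σ Sequent λ Δ →
                    β ≺ α × e ≤ d × (Δ ⊆ Γ , φ) × ⊢ β e Δ

  _⪯_ : E → E → Set
  β ⪯ α = β ≺ α ⊎ β ≡ α

  ≺-⪯-trans : ∀ {γ β α} → γ ≺ β → β ⪯ α → γ ≺ α
  ≺-⪯-trans γ≺β (inj₁ β≺α)  = ≺-trans γ≺β β≺α
  ≺-⪯-trans γ≺β (inj₂ refl) = γ≺β

  ⪯-⊕ : ∀ α β → α ⪯ (α ⊕ β)
  ⪯-⊕ α β with zero⪯ β
  ... | inj₁ 0≺β = inj₁ (subst (_≺ (α ⊕ β)) (⊕-zero α) (⊕-monoʳ α 0≺β))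
  ... | inj₂ refl = inj₂ (sym (⊕-zero α))

  ⪯-≺-trans : ∀ {γ β α} → γ ⪯ β → β ≺ α → γ ≺ α
  ⪯-≺-trans (inj₁ γ≺β) β≺α = ≺-trans γ≺β β≺α
  ⪯-≺-trans (inj₂ refl) β≺α = β≺α

  ≺-⊕ : ∀ α {β′ β} → β′ ≺ β → α ≺ (α ⊕ β)
  ≺-⊕ α {β′} β′≺β = ⪯-≺-trans (⪯-⊕ α β′) (⊕-monoʳ α β′≺β)

  Premise-mono : ∀ {β α e d Γ φ} → β ⪯ α → e ≤ d → Premise β e Γ φ → Premise α d Γ φ
  Premise-mono β⪯α e≤d (γ , e′ , Δ , γ≺β , e′≤e , Δ⊆ , D) =
    γ , e′ , Δ , ≺-⪯-trans γ≺β β⪯α , ≤-trans e′≤e e≤d , Δ⊆ , D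

  ⊢-mono : ∀ {β α e d Γ} → β ⪯ α → e ≤ d → ⊢ β e Γ → ⊢ α d Γ
  ⊢-mono β⪯α e≤d (ax-lit l∈ l-true)  = ax-lit l∈ l-true
  ⊢-mono β⪯α e≤d (ax-X s∈ t∈ s≡t)    = ax-X s∈ t∈ s≡t
  ⊢-mono β⪯α e≤d (r-∧ φ∈ P)          = r-∧ φ∈ (λ i → Premise-mono β⪯α e≤d (P i))
  ⊢-mono β⪯α e≤d (r-∨ φ∈ (i , P))    = r-∨ φ∈ (i , Premise-mono β⪯α e≤d P)
  ⊢-mono β⪯α e≤d (r-∀ φ∈ P)          = r-∀ φ∈ (λ t → Premise-mono β⪯α e≤d (P t))
  ⊢-mono β⪯α e≤d (r-∃ φ∈ (t , P))    = r-∃ φ∈ (t , Premise-mono β⪯α e≤d P)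
  ⊢-mono β⪯α e≤d (r-X φ∈ P)          = r-X φ∈ (λ s s⊲t → Premise-mono β⪯α e≤d (P s s⊲t))
  ⊢-mono β⪯α e≤d (r-cut φ rk<e P Q)  =
    r-cut φ (<-≤-trans rk<e e≤d) (Premise-mono β⪯α e≤d P) (Premise-mono β⪯α e≤d Q)

  replace : ∀ {α e Γ Γ₁ χ ψ} → χ ⇝ ψ → ⊢ α e Γ₁ → Γ₁ ⊆ Γ , χ → ψ ∈ Γ → ⊢ α e Γ

  replace-premise : ∀ {α e Γ Γ₁ χ ψ φ} → χ ⇝ ψ → Premise α e Γ₁ φ → Γ₁ ⊆ Γ , χ → ψ ∈ Γ →
                    Premise α e Γ φ
  replace-premise χ⇝ψ (β , e′ , Δ , β≺α , e′≤e , Δ⊆ , D) Γ₁⊆ ψ∈Γ =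
    β , e′ , _ ∷ _ , β≺α , e′≤e , ∷-⊆ , replace χ⇝ψ D (⊆-trans Δ⊆ Γ₁⊆) (there ψ∈Γ)

  replace-principal : ∀ {α e Γ Γ₁ χ ψ} → χ ⇝ ψ → Premise α e Γ₁ ψ → Γ₁ ⊆ Γ , χ → ψ ∈ Γ →
                      ⊢ α e Γ
  replace-principal χ⇝ψ (β , e′ , Δ , β≺α , e′≤e , Δ⊆ , D) Γ₁⊆ ψ∈Γ =
    ⊢-mono (inj₁ β≺α) e′≤e (replace χ⇝ψ D (⊆-trans-∈ Δ⊆ Γ₁⊆ ψ∈Γ) ψ∈Γ)

  replace χ⇝ψ (ax-lit l∈ l-true) Γ₁⊆ ψ∈Γ with Γ₁⊆ l∈
  ... | inj₁ l∈Γ = ax-lit l∈Γ l-true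
  ... | inj₂ refl = ⊥-elim (⇝⇒¬TrueLit χ⇝ψ l-true)
  replace χ⇝ψ (ax-X s∈ t∈ s≡t) Γ₁⊆ ψ∈Γ with Γ₁⊆ s∈ | Γ₁⊆ t∈
  replace χ⇝ψ       (ax-X s∈ t∈ s≡t) Γ₁⊆ ψ∈Γ | inj₁ s∈Γ  | inj₁ t∈Γ = ax-X s∈Γ t∈Γ s≡t
  replace (X⇝ u≡s)  (ax-X s∈ t∈ s≡t) Γ₁⊆ ψ∈Γ | inj₂ refl | inj₁ t∈Γ = ax-X ψ∈Γ t∈Γ (trans u≡s s≡t)
  replace ()        (ax-X s∈ t∈ s≡t) Γ₁⊆ ψ∈Γ | _         | inj₂ refl
  replace χ⇝ψ (r-∧ φ∈ P) Γ₁⊆ ψ∈Γ with Γ₁⊆ φ∈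
  replace χ⇝ψ    (r-∧ φ∈ P) Γ₁⊆ ψ∈Γ | inj₁ φ∈Γ = r-∧ φ∈Γ (λ j → replace-premise χ⇝ψ (P j) Γ₁⊆ ψ∈Γ)
  replace (∧⇝ i) (r-∧ φ∈ P) Γ₁⊆ ψ∈Γ | inj₂ refl = replace-principal (∧⇝ i) (P i) Γ₁⊆ ψ∈Γ
  replace χ⇝ψ (r-∨ φ∈ (j , P)) Γ₁⊆ ψ∈Γ with Γ₁⊆ φ∈
  replace χ⇝ψ (r-∨ φ∈ (j , P)) Γ₁⊆ ψ∈Γ | inj₁ φ∈Γ = r-∨ φ∈Γ (j , replace-premise χ⇝ψ P Γ₁⊆ ψ∈Γ)
  replace ()  (r-∨ φ∈ (j , P)) Γ₁⊆ ψ∈Γ | inj₂ refl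
  replace χ⇝ψ (r-∀ φ∈ P) Γ₁⊆ ψ∈Γ with Γ₁⊆ φ∈
  replace χ⇝ψ    (r-∀ φ∈ P) Γ₁⊆ ψ∈Γ | inj₁ φ∈Γ = r-∀ φ∈Γ (λ u → replace-premise χ⇝ψ (P u) Γ₁⊆ ψ∈Γ)
  replace (∀⇝ t) (r-∀ φ∈ P) Γ₁⊆ ψ∈Γ | inj₂ refl = replace-principal (∀⇝ t) (P t) Γ₁⊆ ψ∈Γ
  replace χ⇝ψ (r-∃ φ∈ (u , P)) Γ₁⊆ ψ∈Γ with Γ₁⊆ φ∈
  replace χ⇝ψ (r-∃ φ∈ (u , P)) Γ₁⊆ ψ∈Γ | inj₁ φ∈Γ = r-∃ φ∈Γ (u , replace-premise χ⇝ψ P Γ₁⊆ ψ∈Γ)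
  replace ()  (r-∃ φ∈ (u , P)) Γ₁⊆ ψ∈Γ | inj₂ refl
  replace χ⇝ψ (r-X φ∈ P) Γ₁⊆ ψ∈Γ with Γ₁⊆ φ∈
  replace χ⇝ψ     (r-X φ∈ P) Γ₁⊆ ψ∈Γ | inj₁ φ∈Γ =
    r-X φ∈Γ (λ u u⊲t → replace-premise χ⇝ψ (P u u⊲t) Γ₁⊆ ψ∈Γ)
  replace (X⇝ s≡t) (r-X φ∈ P) Γ₁⊆ ψ∈Γ | inj₂ refl =
    r-X ψ∈Γ (λ u u⊲s → replace-premise (X⇝ s≡t) (P u (subst (Rel⟨ θ ⟩ (val u)) s≡t u⊲s)) Γ₁⊆ ψ∈Γ)
  replace χ⇝ψ (r-cut φ rk<e P Q) Γ₁⊆ ψ∈Γ =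
    r-cut φ rk<e (replace-premise χ⇝ψ P Γ₁⊆ ψ∈Γ) (replace-premise χ⇝ψ Q Γ₁⊆ ψ∈Γ)

  reduce : ∀ {α β d e Γ Γ₀ Γ₁ ψ} → Positive ψ → rk ψ ≤ d →
           ⊢ α d Γ₀ → Γ₀ ⊆ Γ , neg ψ → ⊢ β e Γ₁ → e ≤ d → Γ₁ ⊆ Γ , ψ → ⊢ (α ⊕ β) d Γ

  reduce-premise : ∀ {α β d e Γ Γ₀ Γ₁ ψ φ} → Positive ψ → rk ψ ≤ d →
                   ⊢ α d Γ₀ → Γ₀ ⊆ Γ , neg ψ → Premise β e Γ₁ φ → e ≤ d → Γ₁ ⊆ Γ , ψ →
                   Premise (α ⊕ β) d Γ φ
  reduce-premise {α} pos rkψ≤d D₀ Γ₀⊆ (β′ , e′ , Δ , β′≺β , e′≤e , Δ⊆ , D) e≤d Γ₁⊆ =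
    α ⊕ β′ , _ , _ ∷ _ , ⊕-monoʳ α β′≺β , ≤-refl , ∷-⊆ ,
    reduce pos rkψ≤d D₀ (⊆-weaken Γ₀⊆) D (≤-trans e′≤e e≤d) (⊆-trans Δ⊆ Γ₁⊆)

  reduce-principal : ∀ {α β d e Γ Γ₀ Γ₁ ψ φ} → Positive ψ → rk ψ ≤ d → rk φ < rk ψ →
                     neg ψ ⇝ neg φ → ⊢ α d Γ₀ → Γ₀ ⊆ Γ , neg ψ →
                     Premise β e Γ₁ φ → e ≤ d → Γ₁ ⊆ Γ , ψ → ⊢ (α ⊕ β) d Γ
  reduce-principal {α} {φ = φ} pos rkψ≤d rkφ<rkψ ¬ψ⇝¬φ D₀ Γ₀⊆ P@(_ , _ , _ , β′≺β , _) e≤d Γ₁⊆ =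
    r-cut φ (<-≤-trans rkφ<rkψ rkψ≤d)
      (reduce-premise pos rkψ≤d D₀ Γ₀⊆ P e≤d Γ₁⊆)
      (α , _ , neg φ ∷ _ , ≺-⊕ α β′≺β , ≤-refl , ∷-⊆ ,
        replace ¬ψ⇝¬φ D₀ (⊆-weaken Γ₀⊆) (here refl))

  reduce pos rkψ≤d D₀ Γ₀⊆ (ax-lit l∈ l-true) e≤d Γ₁⊆ with Γ₁⊆ l∈
  ... | inj₁ l∈Γ = ax-lit l∈Γ l-true
  ... | inj₂ refl = ⊥-elim (Positive⇒¬TrueLit pos l-true)
  reduce pos rkψ≤d D₀ Γ₀⊆ (ax-X s∈ t∈ s≡t) e≤d Γ₁⊆ with Γ₁⊆ s∈ | Γ₁⊆ t∈
  reduce pos    rkψ≤d D₀ Γ₀⊆ (ax-X s∈ t∈ s≡t) e≤d Γ₁⊆ | inj₁ s∈Γ  | inj₁ t∈Γ = ax-X s∈Γ t∈Γ s≡t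
  reduce ()     rkψ≤d D₀ Γ₀⊆ (ax-X s∈ t∈ s≡t) e≤d Γ₁⊆ | inj₂ refl | _
  reduce {α} {β} ¬X-pos rkψ≤d D₀ Γ₀⊆ (ax-X s∈ t∈ s≡t) e≤d Γ₁⊆ | inj₁ s∈Γ | inj₂ refl =
    ⊢-mono (⪯-⊕ α β) ≤-refl (replace (X⇝ s≡t) D₀ Γ₀⊆ s∈Γ)
  reduce pos rkψ≤d D₀ Γ₀⊆ (r-∧ φ∈ P) e≤d Γ₁⊆ with Γ₁⊆ φ∈
  reduce pos rkψ≤d D₀ Γ₀⊆ (r-∧ φ∈ P) e≤d Γ₁⊆ | inj₁ φ∈Γ =
    r-∧ φ∈Γ (λ i → reduce-premise pos rkψ≤d D₀ Γ₀⊆ (P i) e≤d Γ₁⊆)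
  reduce () rkψ≤d D₀ Γ₀⊆ (r-∧ φ∈ P) e≤d Γ₁⊆ | inj₂ refl
  reduce pos rkψ≤d D₀ Γ₀⊆ (r-∨ φ∈ (i , P)) e≤d Γ₁⊆ with Γ₁⊆ φ∈
  reduce pos rkψ≤d D₀ Γ₀⊆ (r-∨ φ∈ (i , P)) e≤d Γ₁⊆ | inj₁ φ∈Γ =
    r-∨ φ∈Γ (i , reduce-premise pos rkψ≤d D₀ Γ₀⊆ P e≤d Γ₁⊆)
  reduce pos rkψ≤d D₀ Γ₀⊆ (r-∨ {φ₀} {φ₁} φ∈ (i , P)) e≤d Γ₁⊆ | inj₂ refl =
    reduce-principal pos rkψ≤d (rk-pick< φ₀ φ₁ i) (neg-∨⇝ i) D₀ Γ₀⊆ P e≤d Γ₁⊆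
  reduce pos rkψ≤d D₀ Γ₀⊆ (r-∀ φ∈ P) e≤d Γ₁⊆ with Γ₁⊆ φ∈
  reduce pos rkψ≤d D₀ Γ₀⊆ (r-∀ φ∈ P) e≤d Γ₁⊆ | inj₁ φ∈Γ =
    r-∀ φ∈Γ (λ t → reduce-premise pos rkψ≤d D₀ Γ₀⊆ (P t) e≤d Γ₁⊆)
  reduce () rkψ≤d D₀ Γ₀⊆ (r-∀ φ∈ P) e≤d Γ₁⊆ | inj₂ refl
  reduce pos rkψ≤d D₀ Γ₀⊆ (r-∃ φ∈ (t , P)) e≤d Γ₁⊆ with Γ₁⊆ φ∈
  reduce pos rkψ≤d D₀ Γ₀⊆ (r-∃ φ∈ (t , P)) e≤d Γ₁⊆ | inj₁ φ∈Γ =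
    r-∃ φ∈Γ (t , reduce-premise pos rkψ≤d D₀ Γ₀⊆ P e≤d Γ₁⊆)
  reduce pos rkψ≤d D₀ Γ₀⊆ (r-∃ {φ} φ∈ (t , P)) e≤d Γ₁⊆ | inj₂ refl =
    reduce-principal pos rkψ≤d (rk-inst< φ t) (neg-∃⇝ t) D₀ Γ₀⊆ P e≤d Γ₁⊆
  reduce pos rkψ≤d D₀ Γ₀⊆ (r-X φ∈ P) e≤d Γ₁⊆ with Γ₁⊆ φ∈
  reduce pos rkψ≤d D₀ Γ₀⊆ (r-X φ∈ P) e≤d Γ₁⊆ | inj₁ φ∈Γ =
    r-X φ∈Γ (λ s s⊲t → reduce-premise pos rkψ≤d D₀ Γ₀⊆ (P s s⊲t) e≤d Γ₁⊆)
  reduce () rkψ≤d D₀ Γ₀⊆ (r-X φ∈ P) e≤d Γ₁⊆ | inj₂ refl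
  reduce pos rkψ≤d D₀ Γ₀⊆ (r-cut φ rk<e P Q) e≤d Γ₁⊆ =
    r-cut φ (<-≤-trans rk<e e≤d)
      (reduce-premise pos rkψ≤d D₀ Γ₀⊆ P e≤d Γ₁⊆) (reduce-premise pos rkψ≤d D₀ Γ₀⊆ Q e≤d Γ₁⊆)

  cut-admissible : ∀ {γ d Γ} (φ : Sentence) → rk φ ≤ d →
                   Premise (ωf γ) d Γ φ → Premise (ωf γ) d Γ (neg φ) → ⊢ (ωf γ) d Γ
  cut-admissible φ rkφ≤d (β₀ , e₀ , Δ₀ , β₀≺ , e₀≤d , Δ₀⊆ , D₀) (β₁ , e₁ , Δ₁ , β₁≺ , e₁≤d , Δ₁⊆ , D₁)
    with Positive-or-neg φ
  ... | inj₁ pos =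
    ⊢-mono (inj₁ (ωf-closed β₁≺ β₀≺)) ≤-refl
      (reduce pos rkφ≤d (⊢-mono (inj₂ refl) e₁≤d D₁) Δ₁⊆ D₀ e₀≤d Δ₀⊆)
  ... | inj₂ pos =
    ⊢-mono (inj₁ (ωf-closed β₀≺ β₁≺)) ≤-refl
      (reduce pos (subst (_≤ _) (sym (rk-neg φ)) rkφ≤d)
        (⊢-mono (inj₂ refl) e₀≤d D₀) (subst (Δ₀ ⊆ _ ,_) (sym (neg-involutive φ)) Δ₀⊆)
        D₁ e₁≤d Δ₁⊆)

  cut-elim : ∀ {α e d Γ} → ⊢ α e Γ → e ≤ suc d → ⊢ (ωf α) d Γ

  cut-elim-premise : ∀ {α e d Γ φ} → Premise α e Γ φ → e ≤ suc d → Premise (ωf α) d Γ φ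
  cut-elim-premise (β , e′ , Δ , β≺α , e′≤e , Δ⊆ , D) e≤1+d =
    ωf β , _ , Δ , ωf-mono β≺α , ≤-refl , Δ⊆ , cut-elim D (≤-trans e′≤e e≤1+d)

  cut-elim (ax-lit l∈ l-true) _    = ax-lit l∈ l-true
  cut-elim (ax-X s∈ t∈ s≡t) _      = ax-X s∈ t∈ s≡t
  cut-elim (r-∧ φ∈ P) e≤1+d        = r-∧ φ∈ (λ i → cut-elim-premise (P i) e≤1+d)
  cut-elim (r-∨ φ∈ (i , P)) e≤1+d  = r-∨ φ∈ (i , cut-elim-premise P e≤1+d)
  cut-elim (r-∀ φ∈ P) e≤1+d        = r-∀ φ∈ (λ t → cut-elim-premise (P t) e≤1+d)
  cut-elim (r-∃ φ∈ (t , P)) e≤1+d  = r-∃ φ∈ (t , cut-elim-premise P e≤1+d)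
  cut-elim (r-X φ∈ P) e≤1+d        = r-X φ∈ (λ s s⊲t → cut-elim-premise (P s s⊲t) e≤1+d)
  cut-elim (r-cut φ rk<e P Q) e≤1+d =
    cut-admissible φ (s≤s⁻¹ (<-≤-trans rk<e e≤1+d))
      (cut-elim-premise P e≤1+d) (cut-elim-premise Q e≤1+d)

  ωn-ωf : ∀ α d → ωn (ωf α) d ≡ ωf (ωn α d)
  ωn-ωf α zero    = refl
  ωn-ωf α (suc d) = cong ωf (ωn-ωf α d)

  cut-elim-all : ∀ α d {Γ} → ⊢ α d Γ → ⊢ (ωn α d) 0 Γ
  cut-elim-all α zero    D = D
  cut-elim-all α (suc d) D =
    subst (λ γ → ⊢ γ 0 _) (ωn-ωf α d) (cut-elim-all (ωf α) d (cut-elim D ≤-refl))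

theorem4p7 : (O : OrdStructure) (θ : Formula 2) → DefinesWellOrder θ →
    let open Derivability O θ in
    (∀ (α : OrdStructure.E O) (d : ℕ) (Γ : Sequent) → ⊢ α (suc d) Γ → ⊢ (OrdStructure.ωf O α) d Γ)
    × (∀ (α : OrdStructure.E O) (d : ℕ) (Γ : Sequent) → ⊢ α d Γ → ⊢ (ωn α d) 0 Γ)
theorem4p7 O θ _ =
  (λ α d Γ D → cut-elim D ≤-refl) , (λ α d Γ → cut-elim-all α d)
  where open CutElimination O θ
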